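{- Let $G$ and $H$ be vertex-disjoint simple graphs, let $u\in V(G)$ and $v\in V(H)$, and let $G\cdot H$ be the graph obtained from $G\cup H$ by identifying $u$ with $v$. Let $\alpha\in[0,1]$. Then \[ P_{L_\alpha(G\cdot H)}(\lambda)=P_{L_\alpha(G)}(\lambda)\,P_{L_\alpha(H)_v}(\lambda)+P_{L_\alpha(G)_u}(\lambda)\,P_{L_\alpha(H)}(\lambda)-\lambda\,P_{L_\alpha(G)_u}(\lambda)\,P_{L_\alpha(H)_v}(\lambda) \] as polynomials in $\lambda$.
   Context: For a simple graph $G$ with adjacency matrix $A(G)$ and diagonal degree matrix $D(G)$, and $\alpha\in[0,1]$, define $L_\alpha(G)=\alpha D(G)+(\alpha-1)A(G)$. For a square matrix $M$, $P_M(\lambda)=\det(\lambda I-M)$ is its characteristic polynomial. $L_\alpha(G)_u$ denotes the principal submatrix of $L_\alpha(G)$ obtained by deleting the row and column corresponding to vertex $u$ (note it keeps the degrees from $G$ on the diagonal). The coalescence $G\cdot H$ has $|V(G)|+|V(H)|-1$ vertices; the identified vertex is adjacent to all neighbors of $u$ in $G$ and all neighbors of $v$ in $H$. -}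

module Defs where

open import Level using (Level)
open import Data.Bool using (Bool; true; false; _∨_; _∧_)
open import Data.Nat using (ℕ; zero; suc) renaming (_+_ to _+ℕ_)
open import Data.Fin using (Fin; zero; suc; punchIn; punchOut; _↑ˡ_; _↑ʳ_; splitAt; toℕ)
open import Data.Fin.Properties using (_≟_)
open import Data.Maybe using (Maybe; just; nothing)
open import Data.Sum using (inj₁; inj₂)
open import Relation.Nullary using (yes; no)
open import Relation.Binary.PropositionalEquality using (_≡_)
open import Algebra.Bundles using (CommutativeRing)

record SimpleGraph (n : ℕ) : Set where
  field
    adj    : Fin n → Fin n → Bool
    sym    : ∀ i j → adj i j ≡ adj j i
    irrefl : ∀ i → adj i i ≡ false
open SimpleGraph public

-- Vertex set Fin (suc m +ℕ n):
-- the first suc m vertices are those of G (u plays the role of the identified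
-- vertex), the remaining n are the vertices of H other than v
-- (vertex j ↦ punchIn v j of H).
module _ {m n : ℕ} where
  coalG : Fin (suc m) → Fin (suc m +ℕ n) → Maybe (Fin (suc m))
  coalG u x with splitAt (suc m) x
  ... | inj₁ i = just i
  ... | inj₂ j = nothing

  coalH : Fin (suc m) → Fin (suc n) → Fin (suc m +ℕ n) → Maybe (Fin (suc n))
  coalH u v x with splitAt (suc m) x
  ... | inj₁ i with i ≟ u
  ...   | yes _ = just v
  ...   | no  _ = nothing
  coalH u v x | inj₂ j = just (punchIn v j)

  liftAdj : {k : ℕ} → (Fin k → Fin k → Bool) → Maybe (Fin k) → Maybe (Fin k) → Bool
  liftAdj a (just i) (just j) = a i j
  liftAdj a _ _ = false

  coalAdj : SimpleGraph (suc m) → Fin (suc m) → SimpleGraph (suc n) → Fin (suc n)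
          → Fin (suc m +ℕ n) → Fin (suc m +ℕ n) → Bool
  coalAdj G u H v x y =
    liftAdj (adj G) (coalG u x) (coalG u y) ∨ liftAdj (adj H) (coalH u v x) (coalH u v y)

module Matrices {c ℓ : Level} (R : CommutativeRing c ℓ) where
  open CommutativeRing R hiding (zero)

  Mat : ℕ → Set c
  Mat n = Fin n → Fin n → Carrier

  sumF : (n : ℕ) → (Fin n → Carrier) → Carrier
  sumF zero f = 0#
  sumF (suc n) f = f zero + sumF n (λ i → f (suc i))

  sgn : ℕ → Carrier
  sgn zero = 1#
  sgn (suc k) = - sgn k

  det : (n : ℕ) → Mat n → Carrier
  det zero M = 1#
  det (suc n) M = sumF (suc n) (λ j → sgn (toℕ j) * (M zero j * det n (λ a b → M (suc a) (punchIn j b))))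

  δ : {n : ℕ} → Fin n → Fin n → Carrier
  δ i j with i ≟ j
  ... | yes _ = 1#
  ... | no  _ = 0#

  ⟦_⟧ : Bool → Carrier
  ⟦ true ⟧ = 1#
  ⟦ false ⟧ = 0#

  charPoly : {n : ℕ} → Mat n → Carrier → Carrier
  charPoly {n} M x = det n (λ i j → x * δ i j - M i j)

  degree : {n : ℕ} → (Fin n → Fin n → Bool) → Fin n → Carrier
  degree {n} a i = sumF n (λ j → ⟦ a i j ⟧)

  Lα : {n : ℕ} → Carrier → (Fin n → Fin n → Bool) → Mat n
  Lα α a i j = α * (δ i j * degree a i) + (α - 1#) * ⟦ a i j ⟧

  delete : {n : ℕ} → Fin (suc n) → Mat (suc n) → Mat n
  delete u M i j = M (punchIn u i) (punchIn u j)

module Submission where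

open import Defs hiding (sym)
open import Level using (Level)
open import Data.Nat as ℕ using (ℕ; zero; suc)
import Data.Nat.Properties as ℕₚ
open import Data.Fin using (Fin; zero; suc; punchIn; toℕ; _↑ˡ_; _↑ʳ_; fromℕ; cast; splitAt)
import Data.Fin.Properties as Finₚ
open import Data.Bool using (Bool; false; _∨_)
open import Data.Bool.Properties using (∨-identityʳ)
open import Data.Maybe using (just; nothing)
open import Data.Sum using (_⊎_; inj₁; inj₂; [_,_]′)
open import Data.Empty using (⊥-elim)
open import Relation.Nullary using (Dec; yes; no)
open import Function using (_∘_; id; const)
import Relation.Binary.PropositionalEquality as ≡
open ≡ using (_≡_; _≢_)
open import Algebra.Bundles using (CommutativeRing)

-- Order the vertices of G·H as those of G followed by those of H - v, so that u
-- stands for the identified vertex. Row u of λI - L_α(G·H) is the sum of a part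
-- supported on G (row u of λI - L_α(G)) and a part supported on H (the entries
-- towards H - v and the extra diagonal term -α d_H(v)). By linearity of the
-- determinant in that row, the characteristic polynomial splits into two
-- determinants. The first is block lower triangular with diagonal blocks
-- λI - L_α(G) and λI - L_α(H)_v. The second becomes block upper triangular once u
-- is placed between G - u and H - v; its diagonal blocks are λI - L_α(G)_u and a
-- matrix K that differs from λI - L_α(H) (with v moved to the front) only by λ in
-- the corner, so that det K = P_{L_α(H)} - λ P_{L_α(H)_v}.

toFront : ∀ {n} → Fin (suc n) → Fin (suc n) → Fin (suc n)
toFront k zero    = k
toFront k (suc i) = punchIn k i

-- punchOut′ c j is the index of c once punchIn c j has been removed, i.e.
-- punchOut applied to c ≢ punchIn c j, but by a recursion that computes.
punchOut′ : ∀ {n} → Fin (suc (suc n)) → Fin (suc n) → Fin (suc n)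
punchOut′ zero    j       = zero
punchOut′ (suc c) zero    = c
punchOut′ {suc n} (suc c) (suc j) = suc (punchOut′ c j)

punchIn-punchOut′ : ∀ {n} (c : Fin (suc (suc n))) j → punchIn (punchIn c j) (punchOut′ c j) ≡ c
punchIn-punchOut′ zero    j       = ≡.refl
punchIn-punchOut′ (suc c) zero    = ≡.refl
punchIn-punchOut′ {suc n} (suc c) (suc j) = ≡.cong suc (punchIn-punchOut′ c j)

punchIn-punchOut′-comm : ∀ {n} (c : Fin (suc (suc n))) j (y : Fin n) →
  punchIn (punchIn c j) (punchIn (punchOut′ c j) y) ≡ punchIn c (punchIn j y)
punchIn-punchOut′-comm zero    j       y       = ≡.refl
punchIn-punchOut′-comm (suc c) zero    y       = ≡.refl
punchIn-punchOut′-comm {suc n} (suc c) (suc j) zero    = ≡.refl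
punchIn-punchOut′-comm {suc n} (suc c) (suc j) (suc y) = ≡.cong suc (punchIn-punchOut′-comm c j y)

punchIn-↑ˡ : ∀ {m} n (i : Fin (suc m)) (j : Fin m) → punchIn (i ↑ˡ n) (j ↑ˡ n) ≡ punchIn i j ↑ˡ n
punchIn-↑ˡ n zero    j       = ≡.refl
punchIn-↑ˡ n (suc i) zero    = ≡.refl
punchIn-↑ˡ n (suc i) (suc j) = ≡.cong suc (punchIn-↑ˡ n i j)

punchIn-↑ʳ : ∀ {m} n (i : Fin (suc m)) (h : Fin n) → punchIn (i ↑ˡ n) (m ↑ʳ h) ≡ suc m ↑ʳ h
punchIn-↑ʳ n zero    h = ≡.refl
punchIn-↑ʳ {suc m} n (suc i) h = ≡.cong suc (punchIn-↑ʳ n i h)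

data Split (m n : ℕ) : Fin (m ℕ.+ n) → Set where
  left  : (i : Fin m) → Split m n (i ↑ˡ n)
  right : (j : Fin n) → Split m n (m ↑ʳ j)

split : ∀ m n (x : Fin (m ℕ.+ n)) → Split m n x
split zero    n x       = right x
split (suc m) n zero    = left zero
split (suc m) n (suc x) with split m n x
... | left i  = left (suc i)
... | right j = right j

middleToFront : ∀ m {n} → Fin (m ℕ.+ suc n) → Fin (suc m ℕ.+ n)
middleToFront m {n} x with splitAt m x
... | inj₁ i       = suc (i ↑ˡ n)
... | inj₂ zero    = zero
... | inj₂ (suc h) = suc (m ↑ʳ h)

middleToFront-↑ˡ : ∀ m n (i : Fin m) → middleToFront m (i ↑ˡ suc n) ≡ suc (i ↑ˡ n)
middleToFront-↑ˡ m n i rewrite Finₚ.splitAt-↑ˡ m i (suc n) = ≡.refl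

middleToFront-middle : ∀ m n → middleToFront m {n} (m ↑ʳ zero) ≡ zero
middleToFront-middle m n rewrite Finₚ.splitAt-↑ʳ m (suc n) zero = ≡.refl

middleToFront-↑ʳ : ∀ m n (h : Fin n) → middleToFront m (m ↑ʳ suc h) ≡ suc (m ↑ʳ h)
middleToFront-↑ʳ m n h rewrite Finₚ.splitAt-↑ʳ m (suc n) (suc h) = ≡.refl

toℕ-punchIn-fromℕ : ∀ {m} (a : Fin m) → toℕ (punchIn (fromℕ m) a) ≡ toℕ a
toℕ-punchIn-fromℕ zero    = ≡.refl
toℕ-punchIn-fromℕ (suc a) = ≡.cong suc (toℕ-punchIn-fromℕ a)

cast-by-toℕ : ∀ {a b} .(e : a ≡ b) {x : Fin a} {y : Fin b} → toℕ x ≡ toℕ y → cast e x ≡ y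
cast-by-toℕ e {x} p = Finₚ.toℕ-injective (≡.trans (Finₚ.toℕ-cast e x) p)

module _ where
  open ≡.≡-Reasoning

  middleToFront-toFront : ∀ m n (i : Fin (suc m ℕ.+ n)) →
    middleToFront m (cast (≡.sym (ℕₚ.+-suc m n)) (toFront (fromℕ m ↑ˡ n) i)) ≡ i
  middleToFront-toFront m n zero = ≡.trans (≡.cong (middleToFront m) (cast-by-toℕ _ (begin
      toℕ (fromℕ m ↑ˡ n)  ≡⟨ Finₚ.toℕ-↑ˡ (fromℕ m) n ⟩
      toℕ (fromℕ m)       ≡⟨ Finₚ.toℕ-fromℕ m ⟩
      m                   ≡⟨ ℕₚ.+-identityʳ m ⟨
      m ℕ.+ 0             ≡⟨ Finₚ.toℕ-↑ʳ m zero ⟨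
      toℕ (m ↑ʳ zero {n}) ∎)))
    (middleToFront-middle m n)
  middleToFront-toFront m n (suc x) with split m n x
  ... | left a = ≡.trans (≡.cong (middleToFront m) (cast-by-toℕ _ (begin
      toℕ (punchIn (fromℕ m ↑ˡ n) (a ↑ˡ n)) ≡⟨ ≡.cong toℕ (punchIn-↑ˡ n (fromℕ m) a) ⟩
      toℕ (punchIn (fromℕ m) a ↑ˡ n)        ≡⟨ Finₚ.toℕ-↑ˡ (punchIn (fromℕ m) a) n ⟩
      toℕ (punchIn (fromℕ m) a)             ≡⟨ toℕ-punchIn-fromℕ a ⟩
      toℕ a                                 ≡⟨ Finₚ.toℕ-↑ˡ a (suc n) ⟨
      toℕ (a ↑ˡ suc n)                      ∎)))
    (middleToFront-↑ˡ m n a)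
  ... | right h = ≡.trans (≡.cong (middleToFront m) (cast-by-toℕ _ (begin
      toℕ (punchIn (fromℕ m ↑ˡ n) (m ↑ʳ h)) ≡⟨ ≡.cong toℕ (punchIn-↑ʳ n (fromℕ m) h) ⟩
      toℕ (suc m ↑ʳ h)                      ≡⟨ Finₚ.toℕ-↑ʳ (suc m) h ⟩
      suc (m ℕ.+ toℕ h)                     ≡⟨ ℕₚ.+-suc m (toℕ h) ⟨
      m ℕ.+ suc (toℕ h)                     ≡⟨ Finₚ.toℕ-↑ʳ m (suc h) ⟨
      toℕ (m ↑ʳ suc h)                      ∎)))
    (middleToFront-↑ʳ m n h)

↑ˡ≢↑ʳ : ∀ {m n} (i : Fin m) (j : Fin n) → i ↑ˡ n ≢ m ↑ʳ j
↑ˡ≢↑ʳ {suc m} zero    j ()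
↑ˡ≢↑ʳ {suc m} (suc i) j eq = ↑ˡ≢↑ʳ i j (Finₚ.suc-injective eq)

module CoalescenceAdjacency {m n : ℕ} (G : SimpleGraph (suc m)) (u : Fin (suc m))
                            (H : SimpleGraph (suc n)) (v : Fin (suc n)) where

  coalG-↑ˡ : ∀ p → coalG {m} {n} u (p ↑ˡ n) ≡ just p
  coalG-↑ˡ p rewrite Finₚ.splitAt-↑ˡ (suc m) p n = ≡.refl

  coalG-↑ʳ : ∀ h → coalG {m} {n} u (suc m ↑ʳ h) ≡ nothing
  coalG-↑ʳ h rewrite Finₚ.splitAt-↑ʳ (suc m) n h = ≡.refl

  coalH-u : coalH {m} {n} u v (u ↑ˡ n) ≡ just v
  coalH-u rewrite Finₚ.splitAt-↑ˡ (suc m) u n with u Finₚ.≟ u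
  ... | yes _   = ≡.refl
  ... | no u≢u = ⊥-elim (u≢u ≡.refl)

  coalH-↑ˡ : ∀ p → p ≢ u → coalH {m} {n} u v (p ↑ˡ n) ≡ nothing
  coalH-↑ˡ p p≢u rewrite Finₚ.splitAt-↑ˡ (suc m) p n with p Finₚ.≟ u
  ... | yes p≡u = ⊥-elim (p≢u p≡u)
  ... | no _    = ≡.refl

  coalH-↑ʳ : ∀ h → coalH {m} {n} u v (suc m ↑ʳ h) ≡ just (punchIn v h)
  coalH-↑ʳ h rewrite Finₚ.splitAt-↑ʳ (suc m) n h = ≡.refl

  coalAdj-↑ˡ↑ˡ : ∀ p q → coalAdj G u H v (p ↑ˡ n) (q ↑ˡ n) ≡ adj G p q
  coalAdj-↑ˡ↑ˡ p q rewrite coalG-↑ˡ p | coalG-↑ˡ q = ≡.trans (≡.cong (adj G p q ∨_) viaH) (∨-identityʳ _)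
    where
    -- an edge of H between two vertices of G can only be the loop at v
    viaH : liftAdj {m} {n} (adj H) (coalH u v (p ↑ˡ n)) (coalH u v (q ↑ˡ n)) ≡ false
    viaH with p Finₚ.≟ u | q Finₚ.≟ u
    ... | no p≢u | _ rewrite coalH-↑ˡ p p≢u = ≡.refl
    ... | yes _ | no q≢u rewrite coalH-↑ˡ q q≢u with coalH {m} {n} u v (p ↑ˡ n)
    ...   | just _  = ≡.refl
    ...   | nothing = ≡.refl
    viaH | yes ≡.refl | yes ≡.refl rewrite coalH-u = irrefl H v

  coalAdj-↑ʳ↑ʳ : ∀ h h′ → coalAdj G u H v (suc m ↑ʳ h) (suc m ↑ʳ h′) ≡ adj H (punchIn v h) (punchIn v h′)
  coalAdj-↑ʳ↑ʳ h h′ rewrite coalG-↑ʳ h | coalH-↑ʳ h | coalH-↑ʳ h′ = ≡.refl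

  coalAdj-u↑ʳ : ∀ h → coalAdj G u H v (u ↑ˡ n) (suc m ↑ʳ h) ≡ adj H v (punchIn v h)
  coalAdj-u↑ʳ h rewrite coalG-↑ˡ u | coalG-↑ʳ h | coalH-u | coalH-↑ʳ h = ≡.refl

  coalAdj-↑ʳu : ∀ h → coalAdj G u H v (suc m ↑ʳ h) (u ↑ˡ n) ≡ adj H (punchIn v h) v
  coalAdj-↑ʳu h rewrite coalG-↑ˡ u | coalG-↑ʳ h | coalH-u | coalH-↑ʳ h = ≡.refl

  coalAdj-↑ˡ↑ʳ : ∀ p h → p ≢ u → coalAdj G u H v (p ↑ˡ n) (suc m ↑ʳ h) ≡ false
  coalAdj-↑ˡ↑ʳ p h p≢u rewrite coalG-↑ˡ p | coalG-↑ʳ h | coalH-↑ˡ p p≢u = ≡.refl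

  coalAdj-↑ʳ↑ˡ : ∀ p h → p ≢ u → coalAdj G u H v (suc m ↑ʳ h) (p ↑ˡ n) ≡ false
  coalAdj-↑ʳ↑ˡ p h p≢u rewrite coalG-↑ˡ p | coalG-↑ʳ h | coalH-↑ˡ p p≢u | coalH-↑ʳ h = ≡.refl

module Determinant {c ℓ : Level} (R : CommutativeRing c ℓ) where
  open CommutativeRing R hiding (zero)
  open Matrices R
  open import Relation.Binary.Reasoning.Setoid setoid
  open import Algebra.Properties.Ring ring using (-‿distribˡ-*; -‿distribʳ-*; -‿involutive)
  open import Algebra.Properties.Semiring.Sum semiring
    using (sum; sum-cong-≋; sum-replicate-zero; sum-remove; ∑-distrib-+; ∑-comm; *-distribˡ-sum; *-distribʳ-sum)
  open import Algebra.Solver.Ring.NaturalCoefficients.Default commutativeSemiring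
    using (solve; _:+_; _:*_; _:=_)

  sumF≡sum : ∀ n (f : Fin n → Carrier) → sumF n f ≡ sum f
  sumF≡sum zero    f = ≡.refl
  sumF≡sum (suc n) f = ≡.cong (f zero +_) (sumF≡sum n (f ∘ suc))

  sumF-cong : ∀ n {f g : Fin n → Carrier} → (∀ i → f i ≈ g i) → sumF n f ≈ sumF n g
  sumF-cong n {f} {g} f≈g = begin
    sumF n f ≡⟨ sumF≡sum n f ⟩
    sum f    ≈⟨ sum-cong-≋ f≈g ⟩
    sum g    ≡⟨ sumF≡sum n g ⟨
    sumF n g ∎

  sumF-zero : ∀ n {f : Fin n → Carrier} → (∀ i → f i ≈ 0#) → sumF n f ≈ 0#
  sumF-zero n {f} f≈0 = begin
    sumF n f ≈⟨ sumF-cong n f≈0 ⟩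
    sumF n (λ _ → 0#) ≡⟨ sumF≡sum n (λ _ → 0#) ⟩
    sum {n} (λ _ → 0#) ≈⟨ sum-replicate-zero n ⟩
    0# ∎

  sumF-+ : ∀ n (f g : Fin n → Carrier) → sumF n (λ i → f i + g i) ≈ sumF n f + sumF n g
  sumF-+ n f g = begin
    sumF n (λ i → f i + g i) ≡⟨ sumF≡sum n _ ⟩
    sum (λ i → f i + g i)    ≈⟨ ∑-distrib-+ f g ⟩
    sum f + sum g            ≡⟨ ≡.cong₂ _+_ (sumF≡sum n f) (sumF≡sum n g) ⟨
    sumF n f + sumF n g      ∎

  sumF-*ˡ : ∀ n a (f : Fin n → Carrier) → sumF n (λ i → a * f i) ≈ a * sumF n f
  sumF-*ˡ n a f = begin
    sumF n (λ i → a * f i) ≡⟨ sumF≡sum n _ ⟩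
    sum (λ i → a * f i)    ≈⟨ *-distribˡ-sum a f ⟨
    a * sum f              ≡⟨ ≡.cong (a *_) (sumF≡sum n f) ⟨
    a * sumF n f           ∎

  sumF-*ʳ : ∀ n a (f : Fin n → Carrier) → sumF n (λ i → f i * a) ≈ sumF n f * a
  sumF-*ʳ n a f = begin
    sumF n (λ i → f i * a) ≡⟨ sumF≡sum n _ ⟩
    sum (λ i → f i * a)    ≈⟨ *-distribʳ-sum a f ⟨
    sum f * a              ≡⟨ ≡.cong (_* a) (sumF≡sum n f) ⟨
    sumF n f * a           ∎

  sumF-comm : ∀ m n (f : Fin m → Fin n → Carrier) →
    sumF m (λ i → sumF n (f i)) ≈ sumF n (λ j → sumF m (λ i → f i j))
  sumF-comm m n f = begin
    sumF m (λ i → sumF n (f i))          ≈⟨ sumF-cong m (λ i → reflexive (sumF≡sum n (f i))) ⟩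
    sumF m (λ i → sum (f i))             ≡⟨ sumF≡sum m _ ⟩
    sum (λ i → sum (f i))                ≈⟨ ∑-comm f ⟩
    sum (λ j → sum (λ i → f i j))        ≡⟨ sumF≡sum n _ ⟨
    sumF n (λ j → sum (λ i → f i j))     ≈⟨ sumF-cong n (λ j → reflexive (sumF≡sum m _)) ⟨
    sumF n (λ j → sumF m (λ i → f i j))  ∎

  sumF-remove : ∀ n (k : Fin (suc n)) (f : Fin (suc n) → Carrier) →
    sumF (suc n) f ≈ f k + sumF n (f ∘ punchIn k)
  sumF-remove n k f = begin
    sumF (suc n) f                ≡⟨ sumF≡sum (suc n) f ⟩
    sum f                         ≈⟨ sum-remove {i = k} f ⟩
    f k + sum (f ∘ punchIn k)     ≡⟨ ≡.cong (f k +_) (sumF≡sum n _) ⟨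
    f k + sumF n (f ∘ punchIn k)  ∎

  sumF-↑ : ∀ p q (f : Fin (p ℕ.+ q) → Carrier) →
    sumF (p ℕ.+ q) f ≈ sumF p (λ i → f (i ↑ˡ q)) + sumF q (λ j → f (p ↑ʳ j))
  sumF-↑ zero    q f = sym (+-identityˡ _)
  sumF-↑ (suc p) q f = trans (+-congˡ (sumF-↑ p q (f ∘ suc))) (sym (+-assoc _ _ _))

  -x*-y≈x*y : ∀ x y → - x * - y ≈ x * y
  -x*-y≈x*y x y = begin
    - x * - y    ≈⟨ -‿distribˡ-* x (- y) ⟨
    - (x * - y)  ≈⟨ -‿cong (-‿distribʳ-* x y) ⟨
    - - (x * y)  ≈⟨ -‿involutive _ ⟩
    x * y        ∎

  sgn*sgn≈1 : ∀ a → sgn a * sgn a ≈ 1#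
  sgn*sgn≈1 zero    = *-identityˡ 1#
  sgn*sgn≈1 (suc a) = trans (-x*-y≈x*y _ _) (sgn*sgn≈1 a)

  sgn-punchOut′ : ∀ {n} (c : Fin (suc (suc n))) (j : Fin (suc n)) →
    sgn (toℕ j) * sgn (toℕ (punchOut′ c j)) ≈ - (sgn (toℕ c) * sgn (toℕ (punchIn c j)))
  sgn-punchOut′ zero j = begin
    sgn (toℕ j) * 1#       ≈⟨ *-identityʳ _ ⟩
    sgn (toℕ j)            ≈⟨ -‿involutive _ ⟨
    - - sgn (toℕ j)        ≈⟨ -‿cong (*-identityˡ _) ⟨
    - (1# * - sgn (toℕ j)) ∎
  sgn-punchOut′ (suc c) zero = begin
    1# * sgn (toℕ c)        ≈⟨ *-identityˡ _ ⟩
    sgn (toℕ c)             ≈⟨ -‿involutive _ ⟨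
    - - sgn (toℕ c)         ≈⟨ -‿cong (*-identityʳ _) ⟨
    - (- sgn (toℕ c) * 1#)  ∎
  sgn-punchOut′ {suc n} (suc c) (suc j) =
    trans (-x*-y≈x*y _ _) (trans (sgn-punchOut′ c j) (-‿cong (sym (-x*-y≈x*y _ _))))

  δ-refl : ∀ {k} (i : Fin k) → δ i i ≈ 1#
  δ-refl i with i Finₚ.≟ i
  ... | yes _   = refl
  ... | no i≢i = ⊥-elim (i≢i ≡.refl)

  δ-≢ : ∀ {k} {i j : Fin k} → i ≢ j → δ i j ≈ 0#
  δ-≢ {i = i} {j} i≢j with i Finₚ.≟ j
  ... | yes i≡j = ⊥-elim (i≢j i≡j)
  ... | no _    = refl

  δ-injective : ∀ {k k′} (f : Fin k → Fin k′) → (∀ {i j} → f i ≡ f j → i ≡ j) →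
                ∀ i j → δ (f i) (f j) ≈ δ i j
  δ-injective f f-inj i j with i Finₚ.≟ j
  ... | yes ≡.refl = δ-refl (f i)
  ... | no i≢j     = δ-≢ (i≢j ∘ f-inj)

  minor : ∀ {n} → Fin (suc n) → Fin (suc n) → Mat (suc n) → Mat n
  minor i j M a b = M (punchIn i a) (punchIn j b)

  laplaceTerm : ∀ {n} → Mat (suc n) → Fin (suc n) → Carrier
  laplaceTerm {n} M j = sgn (toℕ j) * (M zero j * det n (minor zero j M))

  _ᵀ : ∀ {n} → Mat n → Mat n
  (M ᵀ) i j = M j i

  det-cong : ∀ n {M N : Mat n} → (∀ i j → M i j ≈ N i j) → det n M ≈ det n N
  det-cong zero    M≈N = refl
  det-cong (suc n) M≈N = sumF-cong (suc n) λ j →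
    *-congˡ {sgn (toℕ j)} (*-cong (M≈N zero j) (det-cong n (λ a b → M≈N (suc a) (punchIn j b))))

  -- Each term of the double expansion along the first row and column is
  -- counted once on either side.
  det-expand-col₀ : ∀ n (M : Mat (suc n)) →
    det (suc n) M ≈ sumF (suc n) (λ i → sgn (toℕ i) * (M i zero * det n (minor i zero M)))
  det-expand-col₀ zero    M = refl
  det-expand-col₀ (suc n) M = +-congˡ (begin
      sumF (suc n) (λ j → - sgn (toℕ j) * (a j * det (suc n) (minor zero (suc j) M)))
    ≈⟨ sumF-cong (suc n) (λ j →
         *-congˡ { - sgn (toℕ j)} (*-congˡ {a j} (det-expand-col₀ n (minor zero (suc j) M)))) ⟩
      sumF (suc n) (λ j → - sgn (toℕ j) * (a j * sumF (suc n) (λ i → sgn (toℕ i) * (b i * D i j))))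
    ≈⟨ sumF-cong (suc n) (λ j → trans (expand (sgn (toℕ j)) (a j) (λ i → sgn (toℕ i) * (b i * D i j)))
                                      (sumF-cong (suc n) (λ i → row-first i j))) ⟩
      sumF (suc n) (λ j → sumF (suc n) (λ i → - F i j))
    ≈⟨ sumF-comm (suc n) (suc n) (λ j i → - F i j) ⟩
      sumF (suc n) (λ i → sumF (suc n) (λ j → - F i j))
    ≈⟨ sumF-cong (suc n) (λ i → trans (expand (sgn (toℕ i)) (b i) (λ j → sgn (toℕ j) * (a j * D i j)))
                                      (sumF-cong (suc n) (λ j → col-first i j))) ⟨
      sumF (suc n) (λ i → - sgn (toℕ i) * (b i * sumF (suc n) (λ j → sgn (toℕ j) * (a j * D i j))))
    ∎)
    where
    a b : Fin (suc n) → Carrier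
    a j = M zero (suc j)
    b i = M (suc i) zero
    D : Fin (suc n) → Fin (suc n) → Carrier
    D i j = det n (λ x y → M (suc (punchIn i x)) (suc (punchIn j y)))
    F : Fin (suc n) → Fin (suc n) → Carrier
    F i j = (sgn (toℕ i) * sgn (toℕ j)) * (a j * (b i * D i j))
    expand : ∀ s t (f : Fin (suc n) → Carrier) → - s * (t * sumF (suc n) f) ≈ sumF (suc n) (λ i → - s * (t * f i))
    expand s t f = trans (*-congˡ (sym (sumF-*ˡ (suc n) t f))) (sym (sumF-*ˡ (suc n) (- s) (λ i → t * f i)))
    row-first : ∀ i j → - sgn (toℕ j) * (a j * (sgn (toℕ i) * (b i * D i j))) ≈ - F i j
    row-first i j = trans (sym (-‿distribˡ-* _ _)) (-‿cong (solve 5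
      (λ si sj x y d → sj :* (x :* (si :* (y :* d))) := (si :* sj) :* (x :* (y :* d)))
      refl (sgn (toℕ i)) (sgn (toℕ j)) (a j) (b i) (D i j)))
    col-first : ∀ i j → - sgn (toℕ i) * (b i * (sgn (toℕ j) * (a j * D i j))) ≈ - F i j
    col-first i j = trans (sym (-‿distribˡ-* _ _)) (-‿cong (solve 5
      (λ si sj x y d → si :* (y :* (sj :* (x :* d))) := (si :* sj) :* (x :* (y :* d)))
      refl (sgn (toℕ i)) (sgn (toℕ j)) (a j) (b i) (D i j)))

  det-transpose : ∀ n (M : Mat n) → det n (M ᵀ) ≈ det n M
  det-transpose zero    M = refl
  det-transpose (suc n) M = trans
    (sumF-cong (suc n) (λ j → *-congˡ {sgn (toℕ j)} (*-congˡ {M j zero} (det-transpose n (minor j zero M)))))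
    (sym (det-expand-col₀ n M))

  det-toFront-rows : ∀ n (k : Fin (suc n)) (M : Mat (suc n)) →
    det (suc n) (M ∘ toFront k) ≈ sgn (toℕ k) * det (suc n) M
  det-toFront-rows zero    zero M = sym (*-identityˡ _)
  det-toFront-rows (suc n) k    M = begin
      det (suc (suc n)) (M ∘ toFront k)
    ≈⟨ det-expand-col₀ (suc n) (M ∘ toFront k) ⟩
      sgn 0 * (M k zero * det (suc n) (minor k zero M))
        + sumF (suc n) (λ i → - sgn (toℕ i) * (M (punchIn k i) zero * det (suc n) (minor (suc i) zero (M ∘ toFront k))))
    ≈⟨ +-cong first (trans (sumF-cong (suc n) rest) (sumF-*ˡ (suc n) (sgn (toℕ k)) (T ∘ punchIn k))) ⟩
      sgn (toℕ k) * T k + sgn (toℕ k) * sumF (suc n) (T ∘ punchIn k)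
    ≈⟨ distribˡ _ _ _ ⟨
      sgn (toℕ k) * (T k + sumF (suc n) (T ∘ punchIn k))
    ≈⟨ *-congˡ (trans (det-expand-col₀ (suc n) M) (sumF-remove (suc n) k T)) ⟨
      sgn (toℕ k) * det (suc (suc n)) M
    ∎
    where
    T : Fin (suc (suc n)) → Carrier
    T r = sgn (toℕ r) * (M r zero * det (suc n) (minor r zero M))
    first : sgn 0 * (M k zero * det (suc n) (minor k zero M)) ≈ sgn (toℕ k) * T k
    first = trans (*-congʳ (sym (sgn*sgn≈1 (toℕ k)))) (*-assoc _ _ _)
    -- The rows left after deleting row punchIn k i of the rotated matrix are
    -- those of minor (punchIn k i) zero M, rotated so that k comes first.
    rest : ∀ i → - sgn (toℕ i) * (M (punchIn k i) zero * det (suc n) (minor (suc i) zero (M ∘ toFront k)))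
                 ≈ sgn (toℕ k) * T (punchIn k i)
    rest i = begin
        - sgn (toℕ i) * (M r zero * det (suc n) (minor (suc i) zero (M ∘ toFront k)))
      ≈⟨ *-congˡ (*-congˡ (det-cong (suc n) (λ a b → reflexive (≡.cong (λ z → M z (suc b)) (rows a))))) ⟩
        - sgn (toℕ i) * (M r zero * det (suc n) (minor r zero M ∘ toFront k′))
      ≈⟨ *-congˡ (*-congˡ (det-toFront-rows n k′ (minor r zero M))) ⟩
        - sgn (toℕ i) * (M r zero * (sgn (toℕ k′) * D))
      ≈⟨ -‿distribˡ-* _ _ ⟨
        - (sgn (toℕ i) * (M r zero * (sgn (toℕ k′) * D)))
      ≈⟨ -‿cong (solve 4 (λ s t x d → s :* (x :* (t :* d)) := (s :* t) :* (x :* d)) refl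
                     (sgn (toℕ i)) (sgn (toℕ k′)) (M r zero) D) ⟩
        - ((sgn (toℕ i) * sgn (toℕ k′)) * (M r zero * D))
      ≈⟨ -‿cong (*-congʳ (sgn-punchOut′ k i)) ⟩
        - (- (sgn (toℕ k) * sgn (toℕ r)) * (M r zero * D))
      ≈⟨ -‿cong (-‿distribˡ-* _ _) ⟨
        - - ((sgn (toℕ k) * sgn (toℕ r)) * (M r zero * D))
      ≈⟨ trans (-‿involutive _) (*-assoc _ _ _) ⟩
        sgn (toℕ k) * T r
      ∎
      where
      r : Fin (suc (suc n))
      r = punchIn k i
      k′ : Fin (suc n)
      k′ = punchOut′ k i
      D : Carrier
      D = det (suc n) (minor r zero M)
      rows : ∀ a → toFront k (punchIn (suc i) a) ≡ punchIn r (toFront k′ a)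
      rows zero    = ≡.sym (punchIn-punchOut′ k i)
      rows (suc a) = ≡.sym (punchIn-punchOut′-comm k i a)

  det-toFront-cols : ∀ n (k : Fin (suc n)) (M : Mat (suc n)) →
    det (suc n) (λ i → M i ∘ toFront k) ≈ sgn (toℕ k) * det (suc n) M
  det-toFront-cols n k M = begin
    det (suc n) (λ i → M i ∘ toFront k)      ≈⟨ det-transpose (suc n) (λ i → M i ∘ toFront k) ⟨
    det (suc n) (M ᵀ ∘ toFront k)            ≈⟨ det-toFront-rows n k (M ᵀ) ⟩
    sgn (toℕ k) * det (suc n) (M ᵀ)          ≈⟨ *-congˡ (det-transpose (suc n) M) ⟩
    sgn (toℕ k) * det (suc n) M              ∎

  det-toFront : ∀ n (k : Fin (suc n)) (M : Mat (suc n)) →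
    det (suc n) (λ i j → M (toFront k i) (toFront k j)) ≈ det (suc n) M
  det-toFront n k M = begin
    det (suc n) (λ i j → M (toFront k i) (toFront k j))   ≈⟨ det-toFront-rows n k (λ i → M i ∘ toFront k) ⟩
    sgn (toℕ k) * det (suc n) (λ i → M i ∘ toFront k)     ≈⟨ *-congˡ (det-toFront-cols n k M) ⟩
    sgn (toℕ k) * (sgn (toℕ k) * det (suc n) M)           ≈⟨ *-assoc _ _ _ ⟨
    (sgn (toℕ k) * sgn (toℕ k)) * det (suc n) M           ≈⟨ *-congʳ (sgn*sgn≈1 (toℕ k)) ⟩
    1# * det (suc n) M                                    ≈⟨ *-identityˡ _ ⟩
    det (suc n) M                                         ∎

  det-block-lower : ∀ p q (M : Mat (p ℕ.+ q)) → (∀ i j → M (i ↑ˡ q) (p ↑ʳ j) ≈ 0#) →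
    det (p ℕ.+ q) M ≈ det p (λ i j → M (i ↑ˡ q) (j ↑ˡ q)) * det q (λ i j → M (p ↑ʳ i) (p ↑ʳ j))
  det-block-lower zero    q M _     = sym (*-identityˡ _)
  det-block-lower (suc p) q M upper = begin
      det (suc p ℕ.+ q) M
    ≈⟨ sumF-↑ (suc p) q (laplaceTerm M) ⟩
      sumF (suc p) (λ j → laplaceTerm M (j ↑ˡ q)) + sumF q (λ j → laplaceTerm M (suc p ↑ʳ j))
    ≈⟨ +-cong (sumF-cong (suc p) left-term) (sumF-zero q right-term) ⟩
      sumF (suc p) (λ j → laplaceTerm A j * det q D) + 0#
    ≈⟨ trans (+-identityʳ _) (sumF-*ʳ (suc p) (det q D) (laplaceTerm A)) ⟩
      det (suc p) A * det q D
    ∎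
    where
    A : Mat (suc p)
    A i j = M (i ↑ˡ q) (j ↑ˡ q)
    D : Mat q
    D i j = M (suc p ↑ʳ i) (suc p ↑ʳ j)
    right-term : ∀ j → laplaceTerm M (suc p ↑ʳ j) ≈ 0#
    right-term j = trans (*-congˡ (trans (*-congʳ (upper zero j)) (zeroˡ _))) (zeroʳ _)
    left-term : ∀ j → laplaceTerm M (j ↑ˡ q) ≈ laplaceTerm A j * det q D
    left-term j = begin
        laplaceTerm M (j ↑ˡ q)
      ≈⟨ *-cong (reflexive (≡.cong sgn (Finₚ.toℕ-↑ˡ j q)))
                (*-congˡ (det-block-lower p q (minor zero (j ↑ˡ q) M) upper′)) ⟩
        sgn (toℕ j) * (A zero j * (det p (λ a b → M (suc a ↑ˡ q) (punchIn (j ↑ˡ q) (b ↑ˡ q)))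
                                   * det q (λ a b → M (suc p ↑ʳ a) (punchIn (j ↑ˡ q) (p ↑ʳ b)))))
      ≈⟨ *-congˡ (*-congˡ (*-cong (det-cong p (λ a b → reflexive (≡.cong (M (suc a ↑ˡ q)) (punchIn-↑ˡ q j b))))
                                  (det-cong q (λ a b → reflexive (≡.cong (M (suc p ↑ʳ a)) (punchIn-↑ʳ q j b)))))) ⟩
        sgn (toℕ j) * (A zero j * (det p (minor zero j A) * det q D))
      ≈⟨ solve 4 (λ s x d e → s :* (x :* (d :* e)) := (s :* (x :* d)) :* e) refl _ _ _ _ ⟩
        laplaceTerm A j * det q D
      ∎
      where
      upper′ : ∀ a b → minor zero (j ↑ˡ q) M (a ↑ˡ q) (p ↑ʳ b) ≈ 0#
      upper′ a b = trans (reflexive (≡.cong (M (suc a ↑ˡ q)) (punchIn-↑ʳ q j b))) (upper (suc a) b)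

  det-block-upper : ∀ p q (M : Mat (p ℕ.+ q)) → (∀ i j → M (p ↑ʳ i) (j ↑ˡ q) ≈ 0#) →
    det (p ℕ.+ q) M ≈ det p (λ i j → M (i ↑ˡ q) (j ↑ˡ q)) * det q (λ i j → M (p ↑ʳ i) (p ↑ʳ j))
  det-block-upper p q M lower = begin
    det (p ℕ.+ q) M            ≈⟨ det-transpose (p ℕ.+ q) M ⟨
    det (p ℕ.+ q) (M ᵀ)        ≈⟨ det-block-lower p q (M ᵀ) (λ i j → lower j i) ⟩
    det p (λ i j → M (j ↑ˡ q) (i ↑ˡ q)) * det q (λ i j → M (p ↑ʳ j) (p ↑ʳ i))
      ≈⟨ *-cong (det-transpose p (λ i j → M (i ↑ˡ q) (j ↑ˡ q)))
                (det-transpose q (λ i j → M (p ↑ʳ i) (p ↑ʳ j))) ⟩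
    det p (λ i j → M (i ↑ˡ q) (j ↑ˡ q)) * det q (λ i j → M (p ↑ʳ i) (p ↑ʳ j)) ∎

  det-additive-row : ∀ n (k : Fin n) {M M₁ M₂ : Mat n} →
    (∀ j → M k j ≈ M₁ k j + M₂ k j) →
    (∀ i j → i ≢ k → M₁ i j ≈ M i j) → (∀ i j → i ≢ k → M₂ i j ≈ M i j) →
    det n M ≈ det n M₁ + det n M₂
  det-additive-row (suc n) zero {M} {M₁} {M₂} row-k same₁ same₂ =
    trans (sumF-cong (suc n) term) (sumF-+ (suc n) (laplaceTerm M₁) (laplaceTerm M₂))
    where
    term : ∀ j → laplaceTerm M j ≈ laplaceTerm M₁ j + laplaceTerm M₂ j
    term j = begin
        sgn (toℕ j) * (M zero j * D)
      ≈⟨ *-congˡ (*-congʳ (row-k j)) ⟩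
        sgn (toℕ j) * ((M₁ zero j + M₂ zero j) * D)
      ≈⟨ solve 4 (λ s x y d → s :* ((x :+ y) :* d) := s :* (x :* d) :+ s :* (y :* d)) refl _ _ _ _ ⟩
        sgn (toℕ j) * (M₁ zero j * D) + sgn (toℕ j) * (M₂ zero j * D)
      ≈⟨ +-cong (*-congˡ (*-congˡ (det-cong n (λ a b → same₁ (suc a) (punchIn j b) λ ()))))
                (*-congˡ (*-congˡ (det-cong n (λ a b → same₂ (suc a) (punchIn j b) λ ())))) ⟨
        laplaceTerm M₁ j + laplaceTerm M₂ j
      ∎
      where
      D : Carrier
      D = det n (minor zero j M)
  det-additive-row (suc n) (suc k) {M} {M₁} {M₂} row-k same₁ same₂ =
    trans (sumF-cong (suc n) term) (sumF-+ (suc n) (laplaceTerm M₁) (laplaceTerm M₂))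
    where
    term : ∀ j → laplaceTerm M j ≈ laplaceTerm M₁ j + laplaceTerm M₂ j
    term j = begin
        sgn (toℕ j) * (M zero j * det n (minor zero j M))
      ≈⟨ *-congˡ (*-congˡ (det-additive-row n k (λ b → row-k (punchIn j b))
            (λ a b a≢k → same₁ (suc a) (punchIn j b) (a≢k ∘ Finₚ.suc-injective))
            (λ a b a≢k → same₂ (suc a) (punchIn j b) (a≢k ∘ Finₚ.suc-injective)))) ⟩
        sgn (toℕ j) * (M zero j * (det n (minor zero j M₁) + det n (minor zero j M₂)))
      ≈⟨ solve 4 (λ s x d e → s :* (x :* (d :+ e)) := s :* (x :* d) :+ s :* (x :* e)) refl _ _ _ _ ⟩
        sgn (toℕ j) * (M zero j * det n (minor zero j M₁)) + sgn (toℕ j) * (M zero j * det n (minor zero j M₂))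
      ≈⟨ +-cong (*-congˡ (*-congʳ (same₁ zero j λ ()))) (*-congˡ (*-congʳ (same₂ zero j λ ()))) ⟨
        laplaceTerm M₁ j + laplaceTerm M₂ j
      ∎

  det-cast : ∀ {a b} (e : a ≡ b) (M : Mat b) → det a (λ i j → M (cast e i) (cast e j)) ≈ det b M
  det-cast ≡.refl M = det-cong _ λ i j →
    reflexive (≡.cong₂ M (Finₚ.cast-is-id ≡.refl i) (Finₚ.cast-is-id ≡.refl j))

  det-middleToFront : ∀ m n (M : Mat (suc m ℕ.+ n)) →
    det (m ℕ.+ suc n) (λ i j → M (middleToFront m i) (middleToFront m j)) ≈ det (suc m ℕ.+ n) M
  det-middleToFront m n M = begin
      det (m ℕ.+ suc n) N
    ≈⟨ det-cast e N ⟨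
      det (suc m ℕ.+ n) (λ i j → N (cast e i) (cast e j))
    ≈⟨ det-toFront (m ℕ.+ n) k (λ i j → N (cast e i) (cast e j)) ⟨
      det (suc m ℕ.+ n) (λ i j → N (cast e (toFront k i)) (cast e (toFront k j)))
    ≈⟨ det-cong (suc m ℕ.+ n) (λ i j →
         reflexive (≡.cong₂ M (middleToFront-toFront m n i) (middleToFront-toFront m n j))) ⟩
      det (suc m ℕ.+ n) M
    ∎
    where
    e : suc m ℕ.+ n ≡ m ℕ.+ suc n
    e = ≡.sym (ℕₚ.+-suc m n)
    k : Fin (suc m ℕ.+ n)
    k = fromℕ m ↑ˡ n
    N : Mat (m ℕ.+ suc n)
    N i j = M (middleToFront m i) (middleToFront m j)

  replaceRow : ∀ {n} → Fin n → (Fin n → Carrier) → Mat n → Mat n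
  replaceRow k r M i j with i Finₚ.≟ k
  ... | yes _ = r j
  ... | no  _ = M i j

  replaceRow-≡ : ∀ {n} (k : Fin n) r M j → replaceRow k r M k j ≡ r j
  replaceRow-≡ k r M j with k Finₚ.≟ k
  ... | yes _   = ≡.refl
  ... | no k≢k = ⊥-elim (k≢k ≡.refl)

  replaceRow-≢ : ∀ {n} {k i : Fin n} r M j → i ≢ k → replaceRow k r M i j ≡ M i j
  replaceRow-≢ {k = k} {i} r M j i≢k with i Finₚ.≟ k
  ... | yes i≡k = ⊥-elim (i≢k i≡k)
  ... | no _    = ≡.refl

  det-scaled-unit-row₀ : ∀ n t (M : Mat (suc n)) →
    det (suc n) (replaceRow zero (λ j → t * δ zero j) M) ≈ t * det n (minor zero zero M)
  det-scaled-unit-row₀ n t M = begin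
      1# * ((t * 1#) * det n (minor zero zero M)) + sumF n (λ j → laplaceTerm E (suc j))
    ≈⟨ +-cong (trans (*-identityˡ _) (*-congʳ (*-identityʳ t))) (sumF-zero n (λ j →
         trans (*-congˡ (trans (*-congʳ (zeroʳ t)) (zeroˡ _))) (zeroʳ _))) ⟩
      t * det n (minor zero zero M) + 0#
    ≈⟨ +-identityʳ _ ⟩
      t * det n (minor zero zero M)
    ∎
    where
    E : Mat (suc n)
    E = replaceRow zero (λ j → t * δ zero j) M

module CharacteristicMatrix {c ℓ : Level} (R : CommutativeRing c ℓ) (α x : CommutativeRing.Carrier R) where
  open CommutativeRing R hiding (zero)
  open Matrices R
  open Determinant R using (δ-refl; δ-≢; δ-injective)
  open import Relation.Binary.Reasoning.Setoid setoid
  open import Algebra.Properties.Ring ring using (-0#≈0#)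

  charMatrix : ∀ {k} → Mat k → Mat k
  charMatrix L i j = x * δ i j - L i j

  charLα : ∀ {k} → (Fin k → Fin k → Bool) → Mat k
  charLα a = charMatrix (Lα α a)

  ⟦≡⟧ : ∀ {p q} → p ≡ q → ⟦ p ⟧ ≈ ⟦ q ⟧
  ⟦≡⟧ p≡q = reflexive (≡.cong ⟦_⟧ p≡q)

  charLα-cong : ∀ {k k′} {a : Fin k → Fin k → Bool} {b : Fin k′ → Fin k′ → Bool} i j i′ j′ →
    δ i j ≈ δ i′ j′ → (i ≡ j → degree a i ≈ degree b i′) → a i j ≡ b i′ j′ →
    charLα a i j ≈ charLα b i′ j′
  charLα-cong {a = a} {b} i j i′ j′ δ≈ deg≈ a≡b =
    +-cong (*-congˡ δ≈) (-‿cong (+-cong (*-congˡ diagonal) (*-congˡ (⟦≡⟧ a≡b))))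
    where
    diagonal : δ i j * degree a i ≈ δ i′ j′ * degree b i′
    diagonal = by-cases (i Finₚ.≟ j)
      where
      by-cases : Dec (i ≡ j) → δ i j * degree a i ≈ δ i′ j′ * degree b i′
      by-cases (yes i≡j) = *-cong δ≈ (deg≈ i≡j)
      by-cases (no i≢j)  = begin
        δ i j * degree a i    ≈⟨ *-congʳ (δ-≢ i≢j) ⟩
        0# * degree a i       ≈⟨ zeroˡ _ ⟩
        0#                    ≈⟨ zeroˡ _ ⟨
        0# * degree b i′      ≈⟨ *-congʳ (trans (sym δ≈) (δ-≢ i≢j)) ⟨
        δ i′ j′ * degree b i′ ∎

  charLα-zero : ∀ {k} {a : Fin k → Fin k → Bool} i j → i ≢ j → a i j ≡ false → charLα a i j ≈ 0#
  charLα-zero {a = a} i j i≢j no-edge = begin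
      x * δ i j - (α * (δ i j * degree a i) + (α - 1#) * ⟦ a i j ⟧)
    ≈⟨ +-cong (*-congˡ (δ-≢ i≢j))
              (-‿cong (+-cong (*-congˡ (*-congʳ (δ-≢ i≢j))) (*-congˡ (⟦≡⟧ no-edge)))) ⟩
      x * 0# - (α * (0# * degree a i) + (α - 1#) * 0#)
    ≈⟨ +-cong (zeroʳ x) (-‿cong (+-cong (trans (*-congˡ (zeroˡ _)) (zeroʳ α)) (zeroʳ _))) ⟩
      0# - (0# + 0#)
    ≈⟨ trans (+-identityˡ _) (trans (-‿cong (+-identityˡ 0#)) -0#≈0#) ⟩
      0#
    ∎

  charLα-diagonal : ∀ {k} {a : Fin k → Fin k → Bool} i → a i i ≡ false → charLα a i i ≈ x - α * degree a i
  charLα-diagonal {a = a} i no-loop = begin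
      x * δ i i - (α * (δ i i * degree a i) + (α - 1#) * ⟦ a i i ⟧)
    ≈⟨ +-cong (*-congˡ (δ-refl i)) (-‿cong (+-cong (*-congˡ (*-congʳ (δ-refl i))) (*-congˡ (⟦≡⟧ no-loop)))) ⟩
      x * 1# - (α * (1# * degree a i) + (α - 1#) * 0#)
    ≈⟨ +-cong (*-identityʳ x) (-‿cong (trans (+-cong (*-congˡ (*-identityˡ _)) (zeroʳ _)) (+-identityʳ _))) ⟩
      x - α * degree a i
    ∎

  charMatrix-delete : ∀ {k} (u : Fin (suc k)) (L : Mat (suc k)) i j →
    charMatrix L (punchIn u i) (punchIn u j) ≈ charMatrix (delete u L) i j
  charMatrix-delete u L i j = +-congʳ (*-congˡ (δ-injective (punchIn u) (Finₚ.punchIn-injective u _ _) i j))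

module CoalescenceMatrix {c ℓ : Level} (R : CommutativeRing c ℓ) (α x : CommutativeRing.Carrier R)
  {m n : ℕ} (G : SimpleGraph (suc m)) (u : Fin (suc m)) (H : SimpleGraph (suc n)) (v : Fin (suc n)) where
  open CommutativeRing R hiding (zero)
  open Matrices R
  open Determinant R
  open CharacteristicMatrix R α x
  open CoalescenceAdjacency G u H v
  open import Relation.Binary.Reasoning.Setoid setoid
  open import Algebra.Properties.Ring ring using (-‿+-comm)

  A : Fin (suc m ℕ.+ n) → Fin (suc m ℕ.+ n) → Bool
  A = coalAdj G u H v

  C : Mat (suc m ℕ.+ n)
  C = charLα A

  CG : Mat (suc m)
  CG = charLα (adj G)

  CH : Mat (suc n)
  CH = charLα (adj H)

  w : Carrier
  w = - (α * degree (adj H) v)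

  degree-↑ˡ : ∀ p → p ≢ u → degree A (p ↑ˡ n) ≈ degree (adj G) p
  degree-↑ˡ p p≢u = begin
      degree A (p ↑ˡ n)
    ≈⟨ sumF-↑ (suc m) n (λ j → ⟦ A (p ↑ˡ n) j ⟧) ⟩
      sumF (suc m) (λ q → ⟦ A (p ↑ˡ n) (q ↑ˡ n) ⟧) + sumF n (λ h → ⟦ A (p ↑ˡ n) (suc m ↑ʳ h) ⟧)
    ≈⟨ +-cong (sumF-cong (suc m) (λ q → ⟦≡⟧ (coalAdj-↑ˡ↑ˡ p q)))
              (sumF-zero n (λ h → ⟦≡⟧ (coalAdj-↑ˡ↑ʳ p h p≢u))) ⟩
      degree (adj G) p + 0#
    ≈⟨ +-identityʳ _ ⟩
      degree (adj G) p
    ∎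

  degree-without-v : degree (adj H) v ≈ sumF n (λ h → ⟦ adj H v (punchIn v h) ⟧)
  degree-without-v =
    trans (sumF-remove n v (λ j → ⟦ adj H v j ⟧)) (trans (+-congʳ (⟦≡⟧ (irrefl H v))) (+-identityˡ _))

  degree-u : degree A (u ↑ˡ n) ≈ degree (adj G) u + degree (adj H) v
  degree-u = begin
      degree A (u ↑ˡ n)
    ≈⟨ sumF-↑ (suc m) n (λ j → ⟦ A (u ↑ˡ n) j ⟧) ⟩
      sumF (suc m) (λ q → ⟦ A (u ↑ˡ n) (q ↑ˡ n) ⟧) + sumF n (λ h → ⟦ A (u ↑ˡ n) (suc m ↑ʳ h) ⟧)
    ≈⟨ +-cong (sumF-cong (suc m) (λ q → ⟦≡⟧ (coalAdj-↑ˡ↑ˡ u q)))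
              (trans (sumF-cong n (λ h → ⟦≡⟧ (coalAdj-u↑ʳ h))) (sym degree-without-v)) ⟩
      degree (adj G) u + degree (adj H) v
    ∎

  degree-↑ʳ : ∀ h → degree A (suc m ↑ʳ h) ≈ degree (adj H) (punchIn v h)
  degree-↑ʳ h = begin
      degree A (suc m ↑ʳ h)
    ≈⟨ sumF-↑ (suc m) n (λ j → ⟦ A (suc m ↑ʳ h) j ⟧) ⟩
      sumF (suc m) (λ q → ⟦ A (suc m ↑ʳ h) (q ↑ˡ n) ⟧)
        + sumF n (λ h′ → ⟦ A (suc m ↑ʳ h) (suc m ↑ʳ h′) ⟧)
    ≈⟨ +-congʳ (sumF-remove m u (λ q → ⟦ A (suc m ↑ʳ h) (q ↑ˡ n) ⟧)) ⟩
      (⟦ A (suc m ↑ʳ h) (u ↑ˡ n) ⟧ + sumF m (λ q → ⟦ A (suc m ↑ʳ h) (punchIn u q ↑ˡ n) ⟧))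
        + sumF n (λ h′ → ⟦ A (suc m ↑ʳ h) (suc m ↑ʳ h′) ⟧)
    ≈⟨ +-cong (trans (+-cong (⟦≡⟧ (coalAdj-↑ʳu h))
                             (sumF-zero m (λ q → ⟦≡⟧ (coalAdj-↑ʳ↑ˡ (punchIn u q) h (Finₚ.punchInᵢ≢i u q)))))
                     (+-identityʳ _))
              (sumF-cong n (λ h′ → ⟦≡⟧ (coalAdj-↑ʳ↑ʳ h h′))) ⟩
      ⟦ adj H (punchIn v h) v ⟧ + sumF n (λ h′ → ⟦ adj H (punchIn v h) (punchIn v h′) ⟧)
    ≈⟨ sumF-remove n v (λ j → ⟦ adj H (punchIn v h) j ⟧) ⟨
      degree (adj H) (punchIn v h)
    ∎

  ↑ʳ≢u : ∀ h → suc m ↑ʳ h ≢ u ↑ˡ n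
  ↑ʳ≢u h = ↑ˡ≢↑ʳ u h ∘ ≡.sym

  ↑ˡ≢u : ∀ {p} → p ≢ u → p ↑ˡ n ≢ u ↑ˡ n
  ↑ˡ≢u p≢u = p≢u ∘ Finₚ.↑ˡ-injective n _ _

  v≢punchIn : ∀ h → v ≢ punchIn v h
  v≢punchIn h = Finₚ.punchInᵢ≢i v h ∘ ≡.sym

  C-↑ˡ↑ˡ : ∀ p q → p ≢ u ⊎ q ≢ u → C (p ↑ˡ n) (q ↑ˡ n) ≈ CG p q
  C-↑ˡ↑ˡ p q p≢u⊎q≢u =
    charLα-cong {a = A} {b = adj G} (p ↑ˡ n) (q ↑ˡ n) p q
      (δ-injective (_↑ˡ n) (Finₚ.↑ˡ-injective n _ _) p q) same-degree (coalAdj-↑ˡ↑ˡ p q)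
    where
    same-degree : p ↑ˡ n ≡ q ↑ˡ n → degree A (p ↑ˡ n) ≈ degree (adj G) p
    same-degree p≡q =
      degree-↑ˡ p ([ id , (λ q≢u → q≢u ∘ ≡.trans (≡.sym (Finₚ.↑ˡ-injective n p q p≡q))) ]′ p≢u⊎q≢u)

  C-uu : C (u ↑ˡ n) (u ↑ˡ n) ≈ CG u u + w
  C-uu = begin
      C (u ↑ˡ n) (u ↑ˡ n)
    ≈⟨ charLα-diagonal {a = A} (u ↑ˡ n) (≡.trans (coalAdj-↑ˡ↑ˡ u u) (irrefl G u)) ⟩
      x - α * degree A (u ↑ˡ n)
    ≈⟨ +-congˡ (-‿cong (trans (*-congˡ degree-u) (distribˡ α _ _))) ⟩
      x - (α * degree (adj G) u + α * degree (adj H) v)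
    ≈⟨ +-congˡ (-‿+-comm _ _) ⟨
      x + (- (α * degree (adj G) u) + w)
    ≈⟨ +-assoc x _ w ⟨
      (x - α * degree (adj G) u) + w
    ≈⟨ +-congʳ (charLα-diagonal {a = adj G} u (irrefl G u)) ⟨
      CG u u + w
    ∎

  C-↑ʳ↑ʳ : ∀ h h′ → C (suc m ↑ʳ h) (suc m ↑ʳ h′) ≈ CH (punchIn v h) (punchIn v h′)
  C-↑ʳ↑ʳ h h′ = charLα-cong {a = A} {b = adj H} (suc m ↑ʳ h) (suc m ↑ʳ h′) (punchIn v h) (punchIn v h′)
    (trans (δ-injective (suc m ↑ʳ_) (Finₚ.↑ʳ-injective (suc m) _ _) h h′)
           (sym (δ-injective (punchIn v) (Finₚ.punchIn-injective v _ _) h h′)))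
    (λ _ → degree-↑ʳ h) (coalAdj-↑ʳ↑ʳ h h′)

  C-u↑ʳ : ∀ h → C (u ↑ˡ n) (suc m ↑ʳ h) ≈ CH v (punchIn v h)
  C-u↑ʳ h = charLα-cong {a = A} {b = adj H} (u ↑ˡ n) (suc m ↑ʳ h) v (punchIn v h)
    (trans (δ-≢ (↑ˡ≢↑ʳ u h)) (sym (δ-≢ (v≢punchIn h)))) (⊥-elim ∘ ↑ˡ≢↑ʳ u h) (coalAdj-u↑ʳ h)

  C-↑ʳu : ∀ h → C (suc m ↑ʳ h) (u ↑ˡ n) ≈ CH (punchIn v h) v
  C-↑ʳu h = charLα-cong {a = A} {b = adj H} (suc m ↑ʳ h) (u ↑ˡ n) (punchIn v h) v
    (trans (δ-≢ (↑ʳ≢u h)) (sym (δ-≢ (v≢punchIn h ∘ ≡.sym)))) (⊥-elim ∘ ↑ʳ≢u h) (coalAdj-↑ʳu h)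

  C-↑ˡ↑ʳ : ∀ p h → p ≢ u → C (p ↑ˡ n) (suc m ↑ʳ h) ≈ 0#
  C-↑ˡ↑ʳ p h p≢u =
    charLα-zero {a = A} (p ↑ˡ n) (suc m ↑ʳ h) (↑ˡ≢↑ʳ p h) (coalAdj-↑ˡ↑ʳ p h p≢u)

  C-↑ʳ↑ˡ : ∀ p h → p ≢ u → C (suc m ↑ʳ h) (p ↑ˡ n) ≈ 0#
  C-↑ʳ↑ˡ p h p≢u =
    charLα-zero {a = A} (suc m ↑ʳ h) (p ↑ˡ n) (↑ˡ≢↑ʳ p h ∘ ≡.sym) (coalAdj-↑ʳ↑ˡ p h p≢u)

  -- Row u ↑ˡ n of C splits into a part supported on G (row u of CG) and a part
  -- supported on H; the latter carries the extra degree of u at the diagonal.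
  rowG rowH : Fin (suc m ℕ.+ n) → Carrier
  rowG = [ CG u , const 0# ]′ ∘ splitAt (suc m)
  rowH = [ (λ q → w * δ u q) , (λ h → CH v (punchIn v h)) ]′ ∘ splitAt (suc m)

  rowG-↑ˡ : ∀ q → rowG (q ↑ˡ n) ≡ CG u q
  rowG-↑ˡ q = ≡.cong [ CG u , const 0# ]′ (Finₚ.splitAt-↑ˡ (suc m) q n)

  rowG-↑ʳ : ∀ h → rowG (suc m ↑ʳ h) ≡ 0#
  rowG-↑ʳ h = ≡.cong [ CG u , const 0# ]′ (Finₚ.splitAt-↑ʳ (suc m) n h)

  rowH-↑ˡ : ∀ q → rowH (q ↑ˡ n) ≡ w * δ u q
  rowH-↑ˡ q = ≡.cong [ (λ q → w * δ u q) , (λ h → CH v (punchIn v h)) ]′ (Finₚ.splitAt-↑ˡ (suc m) q n)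

  rowH-↑ʳ : ∀ h → rowH (suc m ↑ʳ h) ≡ CH v (punchIn v h)
  rowH-↑ʳ h = ≡.cong [ (λ q → w * δ u q) , (λ h → CH v (punchIn v h)) ]′ (Finₚ.splitAt-↑ʳ (suc m) n h)

  C-row-u : ∀ j → C (u ↑ˡ n) j ≈ rowG j + rowH j
  C-row-u j with split (suc m) n j
  ... | right h = begin
    C (u ↑ˡ n) (suc m ↑ʳ h)                 ≈⟨ C-u↑ʳ h ⟩
    CH v (punchIn v h)                      ≈⟨ +-identityˡ _ ⟨
    0# + CH v (punchIn v h)                 ≡⟨ ≡.cong₂ _+_ (rowG-↑ʳ h) (rowH-↑ʳ h) ⟨
    rowG (suc m ↑ʳ h) + rowH (suc m ↑ʳ h)   ∎
  ... | left q = trans (by-cases (q Finₚ.≟ u)) (reflexive (≡.sym (≡.cong₂ _+_ (rowG-↑ˡ q) (rowH-↑ˡ q))))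
    where
    by-cases : Dec (q ≡ u) → C (u ↑ˡ n) (q ↑ˡ n) ≈ CG u q + w * δ u q
    by-cases (yes ≡.refl) = trans C-uu (+-congˡ (sym (trans (*-congˡ (δ-refl u)) (*-identityʳ w))))
    by-cases (no q≢u)     = begin
      C (u ↑ˡ n) (q ↑ˡ n)  ≈⟨ C-↑ˡ↑ˡ u q (inj₂ q≢u) ⟩
      CG u q               ≈⟨ +-identityʳ _ ⟨
      CG u q + 0#          ≈⟨ +-congˡ (trans (*-congˡ (δ-≢ (q≢u ∘ ≡.sym))) (zeroʳ w)) ⟨
      CG u q + w * δ u q   ∎

  Cᴳ Cᴴ : Mat (suc m ℕ.+ n)
  Cᴳ = replaceRow (u ↑ˡ n) rowG C
  Cᴴ = replaceRow (u ↑ˡ n) rowH C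

  det-C-split : det (suc m ℕ.+ n) C ≈ det (suc m ℕ.+ n) Cᴳ + det (suc m ℕ.+ n) Cᴴ
  det-C-split = det-additive-row (suc m ℕ.+ n) (u ↑ˡ n)
    (λ j → trans (C-row-u j) (reflexive (≡.sym
      (≡.cong₂ _+_ (replaceRow-≡ (u ↑ˡ n) rowG C j) (replaceRow-≡ (u ↑ˡ n) rowH C j)))))
    (λ i j i≢u → reflexive (replaceRow-≢ rowG C j i≢u))
    (λ i j i≢u → reflexive (replaceRow-≢ rowH C j i≢u))

  Hᵥ : Mat n
  Hᵥ = charMatrix (delete v (Lα α (adj H)))

  Gᵤ : Mat m
  Gᵤ = charMatrix (delete u (Lα α (adj G)))

  det-Cᴳ : det (suc m ℕ.+ n) Cᴳ ≈ det (suc m) CG * det n Hᵥ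
  det-Cᴳ = trans (det-block-lower (suc m) n Cᴳ upper-right)
                 (*-cong (det-cong (suc m) upper-left) (det-cong n lower-right))
    where
    upper-right : ∀ p h → Cᴳ (p ↑ˡ n) (suc m ↑ʳ h) ≈ 0#
    upper-right p h with p Finₚ.≟ u
    ... | yes ≡.refl = reflexive (≡.trans (replaceRow-≡ (u ↑ˡ n) rowG C _) (rowG-↑ʳ h))
    ... | no p≢u     = trans (reflexive (replaceRow-≢ rowG C _ (↑ˡ≢u p≢u))) (C-↑ˡ↑ʳ p h p≢u)
    upper-left : ∀ p q → Cᴳ (p ↑ˡ n) (q ↑ˡ n) ≈ CG p q
    upper-left p q with p Finₚ.≟ u
    ... | yes ≡.refl = reflexive (≡.trans (replaceRow-≡ (u ↑ˡ n) rowG C _) (rowG-↑ˡ q))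
    ... | no p≢u     = trans (reflexive (replaceRow-≢ rowG C _ (↑ˡ≢u p≢u))) (C-↑ˡ↑ˡ p q (inj₁ p≢u))
    lower-right : ∀ h h′ → Cᴳ (suc m ↑ʳ h) (suc m ↑ʳ h′) ≈ Hᵥ h h′
    lower-right h h′ = trans (reflexive (replaceRow-≢ rowG C _ (↑ʳ≢u h)))
                             (trans (C-↑ʳ↑ʳ h h′) (charMatrix-delete v (Lα α (adj H)) h h′))

  -- The vertices of H, listed with v first (the order of toFront v), as vertices of G·H.
  vertexH : Fin (suc n) → Fin (suc m ℕ.+ n)
  vertexH zero    = u ↑ˡ n
  vertexH (suc h) = suc m ↑ʳ h

  K : Mat (suc n)
  K a b = Cᴴ (vertexH a) (vertexH b)

  -- Listing the vertices of G·H as (G - u, u, H - v) makes Cᴴ block upper triangular.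
  reorder : Fin (m ℕ.+ suc n) → Fin (suc m ℕ.+ n)
  reorder = toFront (u ↑ˡ n) ∘ middleToFront m

  reorder-↑ˡ : ∀ i → reorder (i ↑ˡ suc n) ≡ punchIn u i ↑ˡ n
  reorder-↑ˡ i = ≡.trans (≡.cong (toFront (u ↑ˡ n)) (middleToFront-↑ˡ m n i)) (punchIn-↑ˡ n u i)

  reorder-↑ʳ : ∀ a → reorder (m ↑ʳ a) ≡ vertexH a
  reorder-↑ʳ zero    = ≡.cong (toFront (u ↑ˡ n)) (middleToFront-middle m n)
  reorder-↑ʳ (suc h) = ≡.trans (≡.cong (toFront (u ↑ˡ n)) (middleToFront-↑ʳ m n h)) (punchIn-↑ʳ n u h)

  det-Cᴴ : det (suc m ℕ.+ n) Cᴴ ≈ det m Gᵤ * det (suc n) K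
  det-Cᴴ = begin
      det (suc m ℕ.+ n) Cᴴ
    ≈⟨ det-toFront (m ℕ.+ n) (u ↑ˡ n) Cᴴ ⟨
      det (suc m ℕ.+ n) (λ i j → Cᴴ (toFront (u ↑ˡ n) i) (toFront (u ↑ˡ n) j))
    ≈⟨ det-middleToFront m n (λ i j → Cᴴ (toFront (u ↑ˡ n) i) (toFront (u ↑ˡ n) j)) ⟨
      det (m ℕ.+ suc n) (λ i j → Cᴴ (reorder i) (reorder j))
    ≈⟨ det-block-upper m (suc n) (λ i j → Cᴴ (reorder i) (reorder j)) lower-left ⟩
      det m (λ i j → Cᴴ (reorder (i ↑ˡ suc n)) (reorder (j ↑ˡ suc n)))
        * det (suc n) (λ a b → Cᴴ (reorder (m ↑ʳ a)) (reorder (m ↑ʳ b)))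
    ≈⟨ *-cong (det-cong m upper-left)
              (det-cong (suc n) (λ a b → reflexive (≡.cong₂ Cᴴ (reorder-↑ʳ a) (reorder-↑ʳ b)))) ⟩
      det m Gᵤ * det (suc n) K
    ∎
    where
    off-u : ∀ i → punchIn u i ↑ˡ n ≢ u ↑ˡ n
    off-u i = ↑ˡ≢u (Finₚ.punchInᵢ≢i u i)
    upper-left : ∀ i j → Cᴴ (reorder (i ↑ˡ suc n)) (reorder (j ↑ˡ suc n)) ≈ Gᵤ i j
    upper-left i j = begin
      Cᴴ (reorder (i ↑ˡ suc n)) (reorder (j ↑ˡ suc n)) ≡⟨ ≡.cong₂ Cᴴ (reorder-↑ˡ i) (reorder-↑ˡ j) ⟩
      Cᴴ (punchIn u i ↑ˡ n) (punchIn u j ↑ˡ n)          ≡⟨ replaceRow-≢ rowH C _ (off-u i) ⟩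
      C (punchIn u i ↑ˡ n) (punchIn u j ↑ˡ n)           ≈⟨ C-↑ˡ↑ˡ _ _ (inj₁ (Finₚ.punchInᵢ≢i u i)) ⟩
      CG (punchIn u i) (punchIn u j)                    ≈⟨ charMatrix-delete u (Lα α (adj G)) i j ⟩
      Gᵤ i j                                            ∎
    lower-left : ∀ a i → Cᴴ (reorder (m ↑ʳ a)) (reorder (i ↑ˡ suc n)) ≈ 0#
    lower-left a i rewrite reorder-↑ʳ a | reorder-↑ˡ i with a
    ... | zero  = begin
      Cᴴ (u ↑ˡ n) (punchIn u i ↑ˡ n)   ≡⟨ ≡.trans (replaceRow-≡ (u ↑ˡ n) rowH C _) (rowH-↑ˡ (punchIn u i)) ⟩
      w * δ u (punchIn u i)             ≈⟨ *-congˡ (δ-≢ (Finₚ.punchInᵢ≢i u i ∘ ≡.sym)) ⟩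
      w * 0#                            ≈⟨ zeroʳ w ⟩
      0#                                ∎
    ... | suc h = trans (reflexive (replaceRow-≢ rowH C _ (↑ʳ≢u h)))
                        (C-↑ʳ↑ˡ (punchIn u i) h (Finₚ.punchInᵢ≢i u i))

  det-CH : det (suc n) CH ≈ det (suc n) K + x * det n Hᵥ
  det-CH = begin
      det (suc n) CH
    ≈⟨ det-toFront n v CH ⟨
      det (suc n) CH-rot
    ≈⟨ det-additive-row (suc n) zero first-row rows-K rows-unit ⟩
      det (suc n) K + det (suc n) (replaceRow zero (λ j → x * δ zero j) CH-rot)
    ≈⟨ +-congˡ (trans (det-scaled-unit-row₀ n x CH-rot)
                      (*-congˡ (det-cong n (charMatrix-delete v (Lα α (adj H)))))) ⟩
      det (suc n) K + x * det n Hᵥ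
    ∎
    where
    CH-rot : Mat (suc n)
    CH-rot a b = CH (toFront v a) (toFront v b)
    K-u : ∀ j → K zero j ≡ rowH (vertexH j)
    K-u j = replaceRow-≡ (u ↑ˡ n) rowH C (vertexH j)
    first-row : ∀ j → CH-rot zero j ≈ K zero j + x * δ zero j
    first-row zero = begin
      CH v v                       ≈⟨ charLα-diagonal {a = adj H} v (irrefl H v) ⟩
      x + w                        ≈⟨ +-comm x w ⟩
      w + x                        ≈⟨ +-cong (trans (*-congˡ (δ-refl u)) (*-identityʳ w)) (*-identityʳ x) ⟨
      w * δ u u + x * 1#           ≡⟨ ≡.cong (_+ x * 1#) (≡.trans (K-u zero) (rowH-↑ˡ u)) ⟨
      K zero zero + x * 1#         ∎
    first-row (suc h) = begin
      CH v (punchIn v h)               ≈⟨ +-identityʳ _ ⟨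
      CH v (punchIn v h) + 0#          ≈⟨ +-congˡ (zeroʳ x) ⟨
      CH v (punchIn v h) + x * 0#      ≡⟨ ≡.cong (_+ x * 0#) (≡.trans (K-u (suc h)) (rowH-↑ʳ h)) ⟨
      K zero (suc h) + x * 0#          ∎
    rows-K : ∀ i j → i ≢ zero → K i j ≈ CH-rot i j
    rows-K zero    j       0≢0 = ⊥-elim (0≢0 ≡.refl)
    rows-K (suc a) zero    _   = trans (reflexive (replaceRow-≢ rowH C _ (↑ʳ≢u a))) (C-↑ʳu a)
    rows-K (suc a) (suc b) _   = trans (reflexive (replaceRow-≢ rowH C _ (↑ʳ≢u a))) (C-↑ʳ↑ʳ a b)
    rows-unit : ∀ i j → i ≢ zero → replaceRow zero (λ j → x * δ zero j) CH-rot i j ≈ CH-rot i j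
    rows-unit zero    j 0≢0 = ⊥-elim (0≢0 ≡.refl)
    rows-unit (suc a) j _   = refl

theorem3p9 : {c ℓ : Level} (R : CommutativeRing c ℓ) → let open CommutativeRing R in let open Matrices R in
    (m n : ℕ) (G : SimpleGraph (suc m)) (u : Fin (suc m)) (H : SimpleGraph (suc n)) (v : Fin (suc n))
    (α x : Carrier) →
    charPoly (Lα α (coalAdj G u H v)) x
      ≈ (charPoly (Lα α (adj G)) x * charPoly (delete v (Lα α (adj H))) x
         + charPoly (delete u (Lα α (adj G))) x * charPoly (Lα α (adj H)) x)
        - x * (charPoly (delete u (Lα α (adj G))) x * charPoly (delete v (Lα α (adj H))) x)
theorem3p9 R m n G u H v α x = begin
    det (suc m ℕ.+ n) C
  ≈⟨ trans det-C-split (+-cong det-Cᴳ det-Cᴴ) ⟩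
    PG * PHᵥ + PGᵤ * det (suc n) K
  ≈⟨ //-rightDividesʳ (x * (PGᵤ * PHᵥ)) _ ⟨
    (PG * PHᵥ + PGᵤ * det (suc n) K) + x * (PGᵤ * PHᵥ) - x * (PGᵤ * PHᵥ)
  ≈⟨ +-congʳ (solve 5 (λ g h a k y → g :* h :+ a :* k :+ y :* (a :* h) := g :* h :+ a :* (k :+ y :* h))
                      refl PG PHᵥ PGᵤ (det (suc n) K) x) ⟩
    (PG * PHᵥ + PGᵤ * (det (suc n) K + x * PHᵥ)) - x * (PGᵤ * PHᵥ)
  ≈⟨ +-congʳ (+-congˡ (*-congˡ det-CH)) ⟨
    (PG * PHᵥ + PGᵤ * det (suc n) CH) - x * (PGᵤ * PHᵥ)
  ∎
  where
  open CommutativeRing R hiding (zero)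
  open Matrices R
  open CoalescenceMatrix R α x G u H v
  open import Relation.Binary.Reasoning.Setoid setoid
  open import Algebra.Properties.Ring ring using (//-rightDividesʳ)
  open import Algebra.Solver.Ring.NaturalCoefficients.Default commutativeSemiring using (solve; _:+_; _:*_; _:=_)
  PG PGᵤ PHᵥ : Carrier
  PG = det (suc m) CG
  PGᵤ = det m Gᵤ
  PHᵥ = det n Hᵥ
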